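{- For any positive integer $q$, the tensor $CW_q$ is not a sub-tensor of $T_G$ for any abelian group $G$ of order $|G|<2q$; that is, there are no injections $a,b,c:\{0,1,\dots,q+1\}\to G$ such that for every term $x_iy_jz_k$ of $CW_q$, $x_{a(i)}y_{b(j)}z_{c(k)}$ is a term of $T_G$.
   Context: $CW_q=x_0y_0z_{q+1}+x_{q+1}y_0z_0+x_0y_{q+1}z_0+\sum_{i=1}^q(x_iy_0z_i+x_0y_iz_i+x_iy_iz_0)$, a tensor over $\{x_0,\dots,x_{q+1}\},\{y_0,\dots,y_{q+1}\},\{z_0,\dots,z_{q+1}\}$. For a finite group $G$ (written multiplicatively), $T_G=\sum_{g,h\in G}x_gy_hz_{gh}$, whose terms are exactly $x_gy_hz_k$ with $gh=k$. -}

module Defs where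

open import Level using (Level; _⊔_)
open import Data.Nat using (ℕ; suc)
open import Data.Fin using (Fin; zero; suc; fromℕ; inject₁)
open import Data.Product using (Σ; _×_)
open import Algebra.Bundles using (AbelianGroup)
open import Function.Bundles using (Bijection)
open import Function.Definitions using (Injective)
open import Relation.Binary.PropositionalEquality using (_≡_; setoid)

lastIdx : (q : ℕ) → Fin (suc (suc q))
lastIdx q = fromℕ (suc q)

-- The middle index i ∈ {1,...,q}, given as i' : Fin q with i = i' + 1.
midIdx : (q : ℕ) → Fin q → Fin (suc (suc q))
midIdx q i = suc (inject₁ i)

data CWTerm (q : ℕ) : Fin (suc (suc q)) → Fin (suc (suc q)) → Fin (suc (suc q)) → Set where
  t00L : CWTerm q zero zero (lastIdx q)
  tL00 : CWTerm q (lastIdx q) zero zero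
  t0L0 : CWTerm q zero (lastIdx q) zero
  ti0i : (i : Fin q) → CWTerm q (midIdx q i) zero (midIdx q i)
  t0ii : (i : Fin q) → CWTerm q zero (midIdx q i) (midIdx q i)
  tii0 : (i : Fin q) → CWTerm q (midIdx q i) (midIdx q i) zero

HasOrder : {c ℓ : Level} → AbelianGroup c ℓ → ℕ → Set (c ⊔ ℓ)
HasOrder G n = Bijection (setoid (Fin n)) (AbelianGroup.setoid G)

TGTerm : {c ℓ : Level} (G : AbelianGroup c ℓ) →
         AbelianGroup.Carrier G → AbelianGroup.Carrier G → AbelianGroup.Carrier G → Set ℓ
TGTerm G g h k = AbelianGroup._≈_ G (AbelianGroup._∙_ G g h) k

InjectiveInto : {c ℓ : Level} (G : AbelianGroup c ℓ) {m : ℕ} → (Fin m → AbelianGroup.Carrier G) → Set ℓ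
InjectiveInto G a = Injective _≡_ (AbelianGroup._≈_ G) a

CWSubTensor : {c ℓ : Level} (q : ℕ) (G : AbelianGroup c ℓ) → Set (c ⊔ ℓ)
CWSubTensor q G =
  Σ (Fin (suc (suc q)) → AbelianGroup.Carrier G) λ a →
  Σ (Fin (suc (suc q)) → AbelianGroup.Carrier G) λ b →
  Σ (Fin (suc (suc q)) → AbelianGroup.Carrier G) λ c →
    InjectiveInto G a × InjectiveInto G b × InjectiveInto G c ×
    (∀ i j k → CWTerm q i j k → TGTerm G (a i) (b j) (c k))

-- Summing the three terms of CW_q through a middle index i shows that every middle image
-- c(i) of an embedding into an abelian group squares to c(0) c(q+1). Consequently the 2q
-- elements c(i) c(1) and c(i) c(q+1) are pairwise distinct: a coincidence between the two
-- families, squared, gives c(0) c(q+1) = c(q+1)², i.e. c(0) = c(q+1). A group of order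
-- less than 2q has no room for them.
module Submission where

open import Defs
open import Level using (Level)
open import Data.Nat using (ℕ; suc; _+_; _*_; _<_; _≤_; NonZero)
open import Data.Nat.Properties using (+-identityʳ; <⇒≱)
open import Data.Fin using (Fin; zero; suc; splitAt; join; inject₁)
open import Data.Fin.Properties using (injective⇒≤; join-splitAt; suc-injective; inject₁-injective)
open import Data.Empty using (⊥-elim)
open import Data.Sum using (_⊎_; inj₁; inj₂)
open import Data.Product using (_,_)
open import Algebra.Bundles using (AbelianGroup)
open import Function.Bundles using (Bijection; Inverse)
open import Function.Definitions using (Injective)
open import Function.Properties.Bijection using (Bijection⇒Inverse)
open import Relation.Binary.Bundles using (Setoid)
open import Relation.Binary.PropositionalEquality using (_≡_; cong; subst; setoid; module ≡-Reasoning)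
open import Relation.Nullary using (¬_)
import Function.Construct.Composition as Compose
import Algebra.Properties.Group as GroupProperties
import Algebra.Properties.CommutativeSemigroup as CommutativeSemigroupProperties
import Relation.Binary.Reasoning.Setoid as SetoidReasoning

injective⇒≤-size : {c ℓ : Level} {S : Setoid c ℓ} {m n : ℕ} →
                   Bijection (setoid (Fin n)) S →
                   {f : Fin m → Setoid.Carrier S} → Injective _≡_ (Setoid._≈_ S) f → m ≤ n
injective⇒≤-size {S = S} bij {f} f-inj = injective⇒≤ from∘f-injective
  where
    open Setoid S using (sym; trans)
    open Inverse (Bijection⇒Inverse bij) using (from; to-cong; strictlyInverseˡ)

    from∘f-injective : Injective _≡_ _≡_ (λ i → from (f i))
    from∘f-injective {i} {j} eq =
      f-inj (trans (sym (strictlyInverseˡ (f i))) (trans (to-cong eq) (strictlyInverseˡ (f j))))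

splitAt-injective : (m n : ℕ) → Injective _≡_ _≡_ (splitAt m {n})
splitAt-injective m n {i} {j} eq = begin
  i                      ≡⟨ join-splitAt m n i ⟨
  join m n (splitAt m i) ≡⟨ cong (join m n) eq ⟩
  join m n (splitAt m j) ≡⟨ join-splitAt m n j ⟩
  j                      ∎
  where open ≡-Reasoning

midIdx-injective : (q : ℕ) → Injective _≡_ _≡_ (midIdx q)
midIdx-injective q eq = inject₁-injective (suc-injective eq)

module _ {c ℓ : Level} (G : AbelianGroup c ℓ) where
  open AbelianGroup G hiding (setoid)
  open GroupProperties group using (∙-cancelˡ; ∙-cancelʳ)
  open CommutativeSemigroupProperties commutativeSemigroup using (interchange)
  open SetoidReasoning (AbelianGroup.setoid G)

  square-≈-product : ∀ {a a₀ b b₀ x x₀ x∞} →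
                     a ∙ b₀ ≈ x → a₀ ∙ b ≈ x → a ∙ b ≈ x₀ → a₀ ∙ b₀ ≈ x∞ →
                     x ∙ x ≈ x₀ ∙ x∞
  square-≈-product {a} {a₀} {b} {b₀} {x} {x₀} {x∞} ab₀≈x a₀b≈x ab≈x₀ a₀b₀≈x∞ = begin
    x ∙ x                 ≈⟨ ∙-cong ab₀≈x (trans (comm b a₀) a₀b≈x) ⟨
    (a ∙ b₀) ∙ (b ∙ a₀)   ≈⟨ interchange a b₀ b a₀ ⟩
    (a ∙ b) ∙ (b₀ ∙ a₀)   ≈⟨ ∙-cong ab≈x₀ (trans (comm b₀ a₀) a₀b₀≈x∞) ⟩
    x₀ ∙ x∞               ∎

  equal-squares⇒≈ : ∀ {u v w x₀ x∞} →
                    u ∙ u ≈ x₀ ∙ x∞ → v ∙ v ≈ x₀ ∙ x∞ → w ∙ w ≈ x₀ ∙ x∞ →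
                    u ∙ v ≈ w ∙ x∞ → x₀ ≈ x∞
  equal-squares⇒≈ {u} {v} {w} {x₀} {x∞} u²≈P v²≈P w²≈P uv≈wx∞ =
    ∙-cancelʳ x∞ x₀ x∞ (∙-cancelˡ (x₀ ∙ x∞) (x₀ ∙ x∞) (x∞ ∙ x∞) (begin
      (x₀ ∙ x∞) ∙ (x₀ ∙ x∞)   ≈⟨ ∙-cong u²≈P v²≈P ⟨
      (u ∙ u) ∙ (v ∙ v)       ≈⟨ interchange u u v v ⟩
      (u ∙ v) ∙ (u ∙ v)       ≈⟨ ∙-cong uv≈wx∞ uv≈wx∞ ⟩
      (w ∙ x∞) ∙ (w ∙ x∞)     ≈⟨ interchange w x∞ w x∞ ⟩
      (w ∙ w) ∙ (x∞ ∙ x∞)     ≈⟨ ∙-cong w²≈P refl ⟩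
      (x₀ ∙ x∞) ∙ (x∞ ∙ x∞)   ∎))

  module CWEmbedding {q : ℕ} (a b c : Fin (suc (suc q)) → Carrier)
                     (c-injective : InjectiveInto G c)
                     (terms : ∀ i j k → CWTerm q i j k → TGTerm G (a i) (b j) (c k)) where

    middle : Fin q → Carrier
    middle i = c (midIdx q i)

    middle-square : ∀ i → middle i ∙ middle i ≈ c zero ∙ c (lastIdx q)
    middle-square i = square-≈-product
      (terms _ _ _ (ti0i i)) (terms _ _ _ (t0ii i)) (terms _ _ _ (tii0 i)) (terms _ _ _ t00L)

    middle-injective : Injective _≡_ _≈_ middle
    middle-injective eq = midIdx-injective q (c-injective eq)

    translates : Fin q → Fin q ⊎ Fin q → Carrier
    translates i₀ (inj₁ i) = middle i ∙ middle i₀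
    translates i₀ (inj₂ i) = middle i ∙ c (lastIdx q)

    first≉last : ∀ i₀ i j → ¬ (middle i ∙ middle i₀ ≈ middle j ∙ c (lastIdx q))
    first≉last i₀ i j eq with c-injective (equal-squares⇒≈
      (middle-square i) (middle-square i₀) (middle-square j) eq)
    ... | ()

    translates-injective : ∀ i₀ → Injective _≡_ _≈_ (translates i₀)
    translates-injective i₀ {inj₁ i} {inj₁ j} eq = cong inj₁ (middle-injective (∙-cancelʳ _ _ _ eq))
    translates-injective i₀ {inj₂ i} {inj₂ j} eq = cong inj₂ (middle-injective (∙-cancelʳ _ _ _ eq))
    translates-injective i₀ {inj₁ i} {inj₂ j} eq = ⊥-elim (first≉last i₀ i j eq)
    translates-injective i₀ {inj₂ i} {inj₁ j} eq = ⊥-elim (first≉last i₀ j i (sym eq))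

lemma6p6 : {c ℓ : Level} (q : ℕ) → .{{NonZero q}} →
           (G : AbelianGroup c ℓ) (n : ℕ) → HasOrder G n → n < 2 * q →
           ¬ CWSubTensor q G
lemma6p6 q@(suc _) G n order n<2q (a , b , c , _ , _ , c-injective , terms) =
  <⇒≱ n<q+q (injective⇒≤-size order
    (Compose.injective _≡_ _≡_ _≈_ (splitAt-injective q q) (translates-injective zero)))
  where
    open AbelianGroup G using (_≈_)
    open CWEmbedding G a b c c-injective terms using (translates-injective)
    n<q+q : n < q + q
    n<q+q = subst (λ k → n < q + k) (+-identityʳ q) n<2q
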